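{- Let $\Pi\subseteq\mathfrak{S}_n$ be a valley-hopping orbit, $\pi\in\Pi$ and $x\in\mathrm{Rix}(\pi)$. Then $x=\beta_1(\varphi_x(\pi))$.
   Context: One-line notation with $\pi_0=\pi_{n+1}=\infty$; a letter $\pi_i$ is a peak if $\pi_{i-1}<\pi_i>\pi_{i+1}$, a valley if $\pi_{i-1}>\pi_i<\pi_{i+1}$, a double ascent if $\pi_{i-1}<\pi_i<\pi_{i+1}$, a double descent if $\pi_{i-1}>\pi_i>\pi_{i+1}$. Rix-factorization $\pi=\alpha_1\cdots\alpha_k\beta$: (1) $w:=\pi$, $i:=0$; (2) if $w$ increasing, $\beta:=w$, stop; else $i:=i+1$, let $x$ be the largest descent of the word $w$, write $w=w'xw''$; (3) if $w'$ empty, $\beta:=w$, stop; else $\alpha_i:=w'x$, $w:=w''$, go to (2). $\beta_1(\pi)$ is the first letter of $\beta$. A rixed point of $\pi$ is a letter of the maximal increasing suffix of $\pi$ not smaller than $\beta_1(\pi)$; $\mathrm{Rix}(\pi)$ is their set. Valley-hopping: for $x\in[n]$ write $\pi=w_1w_2xw_4w_5$ with $w_2$ (resp. $w_4$) the maximal consecutive subword immediately left (resp. right) of $x$ whose letters are all smaller than $x$; $\varphi_x(\pi)=w_1w_4xw_2w_5$ if $x$ is a double ascent or double descent, $\varphi_x(\pi)=\pi$ if $x$ is a peak or valley. The valley-hopping orbit of $\pi$ is $\{\prod_{x\in S}\varphi_x(\pi):S\subseteq[n]\}$. -}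

module Defs where

open import Data.Nat.Base using (ℕ; zero; suc; _<ᵇ_; _≡ᵇ_; _≤_)
open import Data.Bool.Base using (Bool; true; false; if_then_else_; _∧_; not)
open import Data.List.Base using (List; []; _∷_; _++_; reverse; length; head; last)
open import Data.Maybe.Base using (Maybe; just; nothing)
open import Data.Product.Base using (_×_; _,_; Σ)
open import Data.List.Membership.Propositional using (_∈_)
open import Relation.Binary.PropositionalEquality using (_≡_)

takeWhileB : (ℕ → Bool) → List ℕ → List ℕ
takeWhileB p [] = []
takeWhileB p (y ∷ ys) = if p y then y ∷ takeWhileB p ys else []

dropWhileB : (ℕ → Bool) → List ℕ → List ℕ
dropWhileB p [] = []
dropWhileB p (y ∷ ys) = if p y then dropWhileB p ys else y ∷ ys

splitOn : ℕ → List ℕ → List ℕ × List ℕ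
splitOn x [] = [] , []
splitOn x (y ∷ ys) with y ≡ᵇ x
... | true  = [] , ys
... | false with splitOn x ys
...   | (l , r) = y ∷ l , r

descents : List ℕ → List ℕ
descents (a ∷ b ∷ t) = (if b <ᵇ a then a ∷ [] else []) ++ descents (b ∷ t)
descents _ = []

maxAux : ℕ → List ℕ → ℕ
maxAux m [] = m
maxAux m (y ∷ ys) = maxAux (if m <ᵇ y then y else m) ys

maxList : List ℕ → Maybe ℕ
maxList [] = nothing
maxList (y ∷ ys) = just (maxAux y ys)

-- The algorithm computing β, with fuel (each loop strictly shortens w,
-- so fuel = length π suffices).
rixβAux : ℕ → List ℕ → List ℕ
rixβAux zero w = w
rixβAux (suc k) w with maxList (descents w)
... | nothing = w
... | just x with splitOn x w
...   | ([] , _)      = w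
...   | (_ ∷ _ , w'') = rixβAux k w''  -- α_i := w'x, w := w''

rixβ : List ℕ → List ℕ
rixβ π = rixβAux (length π) π

-- β₁(π): first letter of β (nothing only for the empty word)
β₁ : List ℕ → Maybe ℕ
β₁ π = head (rixβ π)

decrPrefix : List ℕ → List ℕ
decrPrefix (a ∷ b ∷ t) = if b <ᵇ a then a ∷ decrPrefix (b ∷ t) else a ∷ []
decrPrefix l = l

maxIncSuffix : List ℕ → List ℕ
maxIncSuffix w = reverse (decrPrefix (reverse w))

_∈Rix_ : ℕ → List ℕ → Set
x ∈Rix π = (x ∈ maxIncSuffix π) × Σ ℕ (λ b → (β₁ π ≡ just b) × (b ≤ x))

-- with the convention π_0 = π_{n+1} = ∞ (nothing = ∞)
leftBelow : Maybe ℕ → ℕ → Bool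
leftBelow nothing  x = false
leftBelow (just a) x = a <ᵇ x

belowRight : ℕ → Maybe ℕ → Bool
belowRight x nothing  = true
belowRight x (just b) = x <ᵇ b

-- double ascent or double descent (letters are distinct)
hoppable : Maybe ℕ → ℕ → Maybe ℕ → Bool
hoppable l x r with leftBelow l x | belowRight x r
... | true  | true  = true
... | false | false = true
... | _     | _     = false

φ : ℕ → List ℕ → List ℕ
φ x π with splitOn x π
... | (L , R) =
  let small = λ y → y <ᵇ x
      w2 = reverse (takeWhileB small (reverse L))
      w1 = reverse (dropWhileB small (reverse L))
      w4 = takeWhileB small R
      w5 = dropWhileB small R
  in if hoppable (last L) x (head R)
     then w1 ++ w4 ++ (x ∷ w2) ++ w5
     else π

module Submission where

open import Defs
open import Data.Nat.Base using (ℕ; suc)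
open import Data.List.Base using (List; map; upTo)
open import Data.Maybe.Base using (just)
open import Data.List.Relation.Binary.Permutation.Propositional using (_↭_)
open import Relation.Binary.PropositionalEquality using (_≡_)

open import Data.Bool.Base using (true; false; if_then_else_)
open import Data.Bool.Properties using (T-≡)
open import Data.List.Base using ([]; _∷_; _++_; _∷ʳ_; _ʳ++_; reverse; length; head; last; initLast; _∷ʳ′_)
open import Data.List.Properties using (++-assoc; ++-identityʳ; reverse-++; reverse-involutive; ∷ʳ-++)
open import Data.List.Membership.Propositional using (_∈_; _∉_)
open import Data.List.Membership.Propositional.Properties using (∈-++⁺ˡ; ∈-++⁺ʳ; ∈-++⁻; ∈-∃++)
open import Data.List.Relation.Binary.Permutation.Propositional using (↭-sym; ↭⇒↭ₛ)
open import Data.List.Relation.Binary.Permutation.Propositional.Properties using (shift)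
import Data.List.Relation.Binary.Permutation.Setoid.Properties as ↭ₛ
open import Data.List.Relation.Unary.All using (All; []; _∷_; lookup)
import Data.List.Relation.Unary.All as All
import Data.List.Relation.Unary.All.Properties as All
open import Data.List.Relation.Unary.Any using (here; there)
import Data.List.Relation.Unary.Any.Properties as Any
open import Data.List.Relation.Unary.Linked using (Linked; []; [-]; _∷_)
import Data.List.Relation.Unary.Linked as Linked
open import Data.List.Relation.Unary.Unique.Propositional using (Unique)
import Data.List.Relation.Unary.Unique.Propositional.Properties as Unique
open import Data.Maybe.Base using (nothing)
open import Data.Maybe.Properties using (just-injective)
open import Data.Maybe.Relation.Unary.All using (just; nothing) renaming (All to MaybeAll)
open import Data.Nat.Base using (zero; _<_; _≤_; _≥_; _>_; _<ᵇ_; _≡ᵇ_; _⊔_; z≤n; s≤s)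
open import Data.Nat.Induction using (<-wellFounded)
open import Data.Nat.Properties
open import Data.List.Membership.DecPropositional _≟_ using (_∈?_)
open import Data.Product.Base using (Σ; ∃; ∃₂; _×_; _,_; proj₂)
open import Data.Sum.Base using (_⊎_; inj₁; inj₂)
open import Function.Base using (flip; _on_)
open import Function.Bundles using (Equivalence)
open import Induction.WellFounded using (Acc; acc)
import Relation.Binary.Construct.On as On
open import Relation.Binary.PropositionalEquality
  using (_≢_; refl; sym; trans; cong; subst; setoid; module ≡-Reasoning)
open import Relation.Nullary using (yes; no; contradiction)
open import Relation.Nullary.Reflects using (ofʸ; ofⁿ)

-- Write π = w₁ w₂ x R, where x R is increasing (x is rixed) and w₂ is the maximal
-- run of letters smaller than x in front of x. Then w₁ is empty or ends in a letter
-- l > x, and φ_x(π) = w₁ x w₂ R. Every descent after l is smaller than l, so l is a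
-- barrier for the Rix-factorization of u l A: it either stops before reaching A,
-- with β₁ ≥ l, or cuts exactly after l and goes on with A; which of the two happens
-- depends on u and l only. For π the first alternative would give β₁(π) ≥ l > x,
-- contradicting x ∈ Rix(π). Hence the factorization of φ_x(π) reaches x w₂ R, whose
-- largest descent, if any, is its first letter x, so that β = x w₂ R.

<⇒<ᵇ≡true : ∀ {m n} → m < n → (m <ᵇ n) ≡ true
<⇒<ᵇ≡true {m} {n} m<n with m <ᵇ n | <ᵇ-reflects-< m n
... | true  | _       = refl
... | false | ofⁿ m≮n = contradiction m<n m≮n

≥⇒<ᵇ≡false : ∀ {m n} → m ≥ n → (m <ᵇ n) ≡ false
≥⇒<ᵇ≡false {m} {n} m≥n with m <ᵇ n | <ᵇ-reflects-< m n
... | false | _       = refl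
... | true  | ofʸ m<n = contradiction m≥n (<⇒≱ m<n)

≡ᵇ-refl : ∀ m → (m ≡ᵇ m) ≡ true
≡ᵇ-refl m = Equivalence.to T-≡ (≡⇒≡ᵇ m m refl)

≢⇒≡ᵇ≡false : ∀ {m n} → m ≢ n → (m ≡ᵇ n) ≡ false
≢⇒≡ᵇ≡false {m} {n} m≢n with m ≡ᵇ n in eq
... | false = refl
... | true  = contradiction (≡ᵇ⇒≡ m n (Equivalence.from T-≡ eq)) m≢n

if<ᵇ≡⊔ : ∀ m n → (if m <ᵇ n then n else m) ≡ m ⊔ n
if<ᵇ≡⊔ m n with m <ᵇ n | <ᵇ-reflects-< m n
... | true  | ofʸ m<n = sym (m≤n⇒m⊔n≡n (<⇒≤ m<n))
... | false | ofⁿ m≮n = sym (m≥n⇒m⊔n≡m (≮⇒≥ m≮n))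

length-suffix-< : ∀ {A : Set} (p : List A) d q → length q < length (p ++ d ∷ q)
length-suffix-< []      d q = n<1+n _
length-suffix-< (y ∷ p) d q = m<n⇒m<1+n (length-suffix-< p d q)

last-∷ʳ : ∀ {A : Set} (xs : List A) x → last (xs ∷ʳ x) ≡ just x
last-∷ʳ []           x = refl
last-∷ʳ (y ∷ [])     x = refl
last-∷ʳ (y ∷ z ∷ xs) x = last-∷ʳ (z ∷ xs) x

All-reverse⁺ : ∀ {A : Set} {P : A → Set} {xs} → All P xs → All P (reverse xs)
All-reverse⁺ pxs = All.tabulate (λ z∈ → lookup pxs (Any.reverse⁻ z∈))

Linked-reverse⁺ : ∀ {A : Set} {R : A → A → Set} {xs} → Linked (flip R) xs → Linked R (reverse xs)
Linked-reverse⁺ []  = []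
Linked-reverse⁺ {xs = _ ∷ _} ↓xs = go ↓xs [-]
  where
  go : ∀ {A : Set} {R : A → A → Set} {x xs ys} →
       Linked (flip R) (x ∷ xs) → Linked R (x ∷ ys) → Linked R (xs ʳ++ x ∷ ys)
  go [-]          ↑ys = ↑ys
  go (Ryx ∷ ↓xs) ↑ys = go ↓xs (Ryx ∷ ↑ys)

Linked-++⁻ʳ : ∀ {A : Set} {R : A → A → Set} xs {ys} → Linked R (xs ++ ys) → Linked R ys
Linked-++⁻ʳ []       ↑ = ↑
Linked-++⁻ʳ (x ∷ xs) ↑ = Linked-++⁻ʳ xs (Linked.tail ↑)

Unique-∉-prefix : ∀ {A : Set} (L : List A) {x R} → Unique (L ++ x ∷ R) → x ∉ L
Unique-∉-prefix {A} L {x} {R} unique x∈L =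
  Unique.Unique[x∷xs]⇒x∉xs (↭ₛ.Unique-resp-↭ (setoid A) (↭⇒↭ₛ (shift x L R)) unique) (∈-++⁺ˡ x∈L)

first-occurrence : ∀ {d} u → d ∈ u → ∃₂ λ p q → u ≡ p ++ d ∷ q × d ∉ p
first-occurrence {d} (y ∷ u) d∈ with y ≟ d
... | yes refl = [] , u , refl , λ ()
... | no  y≢d with d∈
...   | here d≡y  = contradiction (sym d≡y) y≢d
...   | there d∈u with first-occurrence u d∈u
...     | p , q , refl , d∉p = y ∷ p , q , refl , λ where
          (here d≡y)  → y≢d (sym d≡y)
          (there d∈p) → d∉p d∈p

splitOn-first : ∀ {d} p t → d ∉ p → splitOn d (p ++ d ∷ t) ≡ (p , t)
splitOn-first {d} []      t d∉p rewrite ≡ᵇ-refl d = refl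
splitOn-first {d} (y ∷ p) t d∉p
  rewrite ≢⇒≡ᵇ≡false {y} {d} (λ y≡d → d∉p (here (sym y≡d)))
        | splitOn-first p t (λ d∈p → d∉p (there d∈p)) = refl

splitOn-shrinks : ∀ d y ys → length (proj₂ (splitOn d (y ∷ ys))) ≤ length ys
splitOn-shrinks d y [] with y ≡ᵇ d
... | true  = z≤n
... | false = z≤n
splitOn-shrinks d y (z ∷ zs) with y ≡ᵇ d
... | true  = ≤-refl
... | false with splitOn d (z ∷ zs) | splitOn-shrinks d z zs
...   | _ , r | r≤zs = m≤n⇒m≤1+n r≤zs

takeWhileB-++ : ∀ {p} ys {zs} → All (λ y → p y ≡ true) ys → MaybeAll (λ z → p z ≡ false) (head zs) →
                takeWhileB p (ys ++ zs) ≡ ys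
takeWhileB-++ []       {[]}    []         nothing   = refl
takeWhileB-++ []       {z ∷ _} []         (just pz) rewrite pz = refl
takeWhileB-++ (y ∷ ys)         (py ∷ pys) stop      rewrite py = cong (y ∷_) (takeWhileB-++ ys pys stop)

dropWhileB-++ : ∀ {p} ys {zs} → All (λ y → p y ≡ true) ys → MaybeAll (λ z → p z ≡ false) (head zs) →
                dropWhileB p (ys ++ zs) ≡ zs
dropWhileB-++ []       {[]}    []         nothing   = refl
dropWhileB-++ []       {z ∷ _} []         (just pz) rewrite pz = refl
dropWhileB-++ (y ∷ ys)         (py ∷ pys) stop      rewrite py = dropWhileB-++ ys pys stop

maxAux-upper : ∀ m ys → All (_≤ maxAux m ys) (m ∷ ys)
maxAux-upper m []       = ≤-refl ∷ []
maxAux-upper m (y ∷ ys) rewrite if<ᵇ≡⊔ m y with maxAux-upper (m ⊔ y) ys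
... | m⊔y≤M ∷ ys≤M = ≤-trans (m≤m⊔n m y) m⊔y≤M ∷ ≤-trans (m≤n⊔m m y) m⊔y≤M ∷ ys≤M

maxAux-∈ : ∀ m ys → maxAux m ys ∈ m ∷ ys
maxAux-∈ m []       = here refl
maxAux-∈ m (y ∷ ys) rewrite if<ᵇ≡⊔ m y with maxAux-∈ (m ⊔ y) ys | ⊔-sel m y
... | here M≡m⊔y | inj₁ m⊔y≡m = here (trans M≡m⊔y m⊔y≡m)
... | here M≡m⊔y | inj₂ m⊔y≡y = there (here (trans M≡m⊔y m⊔y≡y))
... | there M∈ys | _          = there (there M∈ys)

maxList≡just : ∀ {d xs} → d ∈ xs → All (_≤ d) xs → maxList xs ≡ just d
maxList≡just {xs = y ∷ ys} d∈xs xs≤d =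
  cong just (≤-antisym (lookup xs≤d (maxAux-∈ y ys)) (lookup (maxAux-upper y ys) d∈xs))

descents-⊆ : ∀ w {z} → z ∈ descents w → z ∈ w
descents-⊆ (a ∷ b ∷ t) z∈ with b <ᵇ a | descents-⊆ (b ∷ t)
descents-⊆ (a ∷ b ∷ t) (here refl) | true  | _  = here refl
descents-⊆ (a ∷ b ∷ t) (there z∈)  | true  | ih = there (ih z∈)
descents-⊆ (a ∷ b ∷ t) z∈          | false | ih = there (ih z∈)

descents-++ : ∀ u l t → descents (u ++ l ∷ t) ≡ descents (u ∷ʳ l) ++ descents (l ∷ t)
descents-++ []          l t = refl
descents-++ (y ∷ [])    l t with l <ᵇ y
... | true  = refl
... | false = refl
descents-++ (y ∷ z ∷ u) l t =
  trans (cong (c ++_) (descents-++ (z ∷ u) l t)) (sym (++-assoc c _ _))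
  where c = if z <ᵇ y then y ∷ [] else []

descents-∷-desc : ∀ {x y} t → y < x → descents (x ∷ y ∷ t) ≡ x ∷ descents (y ∷ t)
descents-∷-desc t y<x rewrite <⇒<ᵇ≡true y<x = refl

descents-∷-All : ∀ {P : ℕ → Set} {y} w → P y → All P (descents w) → All P (descents (y ∷ w))
descents-∷-All         []      py pw = []
descents-∷-All {y = y} (z ∷ w) py pw with z <ᵇ y
... | true  = py ∷ pw
... | false = pw

descents-++-All : ∀ {P : ℕ → Set} u {t} → All P u → All P (descents t) → All P (descents (u ++ t))
descents-++-All []      []        pt = pt
descents-++-All (y ∷ u) (py ∷ pu) pt = descents-∷-All (u ++ _) py (descents-++-All u pu pt)

descents-increasing : ∀ {w} → Linked _<_ w → descents w ≡ []
descents-increasing []                  = refl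
descents-increasing [-]                 = refl
descents-increasing (_∷_ {x} {y} x<y ↑) rewrite ≥⇒<ᵇ≡false {y} {x} (<⇒≤ x<y) = descents-increasing ↑

rixβAux-fuel : ∀ {j k} w → length w ≤ j → length w ≤ k → rixβAux j w ≡ rixβAux k w
rixβAux-fuel {zero}  {zero}  []       _  _ = refl
rixβAux-fuel {zero}  {suc k} []       _  _ = refl
rixβAux-fuel {suc j} {zero}  []       _  _ = refl
rixβAux-fuel {suc j} {suc k} []       _  _ = refl
rixβAux-fuel {suc j} {suc k} (y ∷ ys) (s≤s ys≤j) (s≤s ys≤k) with maxList (descents (y ∷ ys))
... | nothing = refl
... | just d with splitOn d (y ∷ ys) | splitOn-shrinks d y ys
...   | []    , _  | _      = refl
...   | _ ∷ _ , w′ | w′≤ys = rixβAux-fuel w′ (≤-trans w′≤ys ys≤j) (≤-trans w′≤ys ys≤k)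

rixβ-increasing : ∀ w → descents w ≡ [] → rixβ w ≡ w
rixβ-increasing []       _  = refl
rixβ-increasing (y ∷ ys) eq rewrite eq = refl

rixβ-halt : ∀ {d} t → maxList (descents (d ∷ t)) ≡ just d → rixβ (d ∷ t) ≡ d ∷ t
rixβ-halt {d} t max rewrite max | ≡ᵇ-refl d = refl

rixβ-cut : ∀ {d} y p t → maxList (descents (y ∷ p ++ d ∷ t)) ≡ just d → d ∉ y ∷ p →
           rixβ (y ∷ p ++ d ∷ t) ≡ rixβ t
rixβ-cut {d} y p t max d∉ rewrite max | splitOn-first (y ∷ p) t d∉ =
  rixβAux-fuel t (<⇒≤ (length-suffix-< p d t)) ≤-refl

data Dominates (l : ℕ) : List ℕ → Set where
  dominates : ∀ {a A} → a < l → All (_< l) (descents (a ∷ A)) → Dominates l (a ∷ A)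

Dominates-++ : ∀ {l} u {t} → All (_< l) u → Dominates l t → Dominates l (u ++ t)
Dominates-++ []      []          dom                    = dom
Dominates-++ (y ∷ u) (y<l ∷ u<l) (dominates a<l desc<l) =
  dominates y<l (descents-++-All (y ∷ u) (y<l ∷ u<l) desc<l)

dominates-increasing : ∀ {l a} u {t} → All (_< l) (a ∷ u) → Linked _<_ t → Dominates l (a ∷ u ++ t)
dominates-increasing u (a<l ∷ u<l) ↑t =
  dominates a<l (descents-++-All (_ ∷ u) (a<l ∷ u<l) (subst (All _) (sym (descents-increasing ↑t)) []))

maxList-dominates : ∀ {l A} → Dominates l A → maxList (descents (l ∷ A)) ≡ just l
maxList-dominates {A = a ∷ A} (dominates a<l desc<l) rewrite descents-∷-desc A a<l =
  maxList≡just (here refl) (≤-refl ∷ All.map <⇒≤ desc<l)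

data Barrier (u : List ℕ) (l : ℕ) : Set where
  halts  : ∀ h → l ≤ h → (∀ {A} → Dominates l A → β₁ (u ++ l ∷ A) ≡ just h) → Barrier u l
  passes : (∀ {A} → Dominates l A → rixβ (u ++ l ∷ A) ≡ rixβ A) → Barrier u l

largest-descent : ∀ u l → Σ ℕ λ d → l ≤ d × (d ∈ u ⊎ d ≡ l) ×
                  (∀ {A} → Dominates l A → maxList (descents (u ++ l ∷ A)) ≡ just d)
largest-descent u l = d , l≤d , origin (maxAux-∈ l D) , maximal
  where
  D = descents (u ∷ʳ l)
  d = maxAux l D

  l≤d : l ≤ d
  l≤d = All.head (maxAux-upper l D)

  D≤d : All (_≤ d) D
  D≤d = All.tail (maxAux-upper l D)

  origin : d ∈ l ∷ D → d ∈ u ⊎ d ≡ l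
  origin (here d≡l)  = inj₂ d≡l
  origin (there d∈D) with ∈-++⁻ u (descents-⊆ (u ∷ʳ l) d∈D)
  ... | inj₁ d∈u        = inj₁ d∈u
  ... | inj₂ (here d≡l) = inj₂ d≡l

  maximal : ∀ {A} → Dominates l A → maxList (descents (u ++ l ∷ A)) ≡ just d
  maximal {a ∷ A} (dominates a<l desc<l)
    rewrite descents-++ u l (a ∷ A) | descents-∷-desc A a<l = maxList≡just d∈ bounded
    where
    d∈ : d ∈ D ++ l ∷ descents (a ∷ A)
    d∈ with maxAux-∈ l D
    ... | here d≡l  = ∈-++⁺ʳ D (here d≡l)
    ... | there d∈D = ∈-++⁺ˡ d∈D

    bounded : All (_≤ d) (D ++ l ∷ descents (a ∷ A))
    bounded = All.++⁺ D≤d (l≤d ∷ All.map (λ z<l → ≤-trans (<⇒≤ z<l) l≤d) desc<l)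

-- The largest descent of u l A lies in u l, and after a cut inside u the word left
-- over is again of the form u′ l A, with u′ a proper suffix of u.
barrier : ∀ u l → Barrier u l
barrier u₀ l = go u₀ (On.wellFounded length <-wellFounded u₀)
  where
  cut : ∀ {d A} y p q → maxList (descents ((y ∷ p ++ d ∷ q) ++ l ∷ A)) ≡ just d → d ∉ y ∷ p →
        rixβ ((y ∷ p ++ d ∷ q) ++ l ∷ A) ≡ rixβ (q ++ l ∷ A)
  cut {d} {A} y p q rewrite ++-assoc p (d ∷ q) (l ∷ A) = rixβ-cut y p (q ++ l ∷ A)

  go : ∀ u → Acc (_<_ on length) u → Barrier u l
  go u (acc shorter) with largest-descent u l
  ... | d , l≤d , origin , max with d ∈? u
  ...   | yes d∈u with first-occurrence u d∈u
  ...     | []    , q , refl , _   = halts d l≤d λ {A} dom → cong head (rixβ-halt (q ++ l ∷ A) (max dom))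
  ...     | y ∷ p , q , refl , d∉p with go q (shorter (length-suffix-< (y ∷ p) d q))
  ...       | halts h l≤h β₁≡h = halts h l≤h λ dom → trans (cong head (cut y p q (max dom) d∉p)) (β₁≡h dom)
  ...       | passes β≡        = passes λ dom → trans (cut y p q (max dom) d∉p) (β≡ dom)
  go u       _ | d , l≤d , inj₁ d∈u , max | no d∉u = contradiction d∈u d∉u
  go []      _ | d , l≤d , inj₂ refl , max | no _   = halts d l≤d λ {A} dom → cong head (rixβ-halt A (max dom))
  go (y ∷ u) _ | d , l≤d , inj₂ refl , max | no d∉u = passes λ dom → rixβ-cut y u _ (max dom) d∉u

β₁-leader : ∀ {x w R} → All (_< x) w → Linked _<_ (x ∷ R) → β₁ (x ∷ w ++ R) ≡ just x
β₁-leader {x} {[]}    {R} []          ↑x∷R = cong head (rixβ-increasing (x ∷ R) (descents-increasing ↑x∷R))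
β₁-leader {x} {y ∷ w} {R} (y<x ∷ w<x) ↑x∷R =
  cong head (rixβ-halt (y ∷ w ++ R) (maxList-dominates (dominates-increasing w (y<x ∷ w<x) (Linked.tail ↑x∷R))))

data EndsAbove (x : ℕ) : List ℕ → Set where
  []   : EndsAbove x []
  snoc : ∀ u {l} → x < l → EndsAbove x (u ∷ʳ l)

dominates-around : ∀ {x l w R} → x < l → All (_< x) w → Linked _<_ (x ∷ R) →
                   Dominates l (w ++ x ∷ R) × Dominates l (x ∷ w ++ R)
dominates-around {w = w} x<l w<x ↑x∷R =
  Dominates-++ w w<l (dominates-increasing [] (x<l ∷ []) (Linked.tail ↑x∷R)) ,
  dominates-increasing w (x<l ∷ w<l) (Linked.tail ↑x∷R)
  where
  w<l = All.map (λ y<x → <-trans y<x x<l) w<x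

β₁-hop : ∀ {x b w₁ w₂ R} → EndsAbove x w₁ → All (_< x) w₂ → Linked _<_ (x ∷ R) →
         β₁ ((w₁ ++ w₂) ++ x ∷ R) ≡ just b → b ≤ x → β₁ (w₁ ++ x ∷ w₂ ++ R) ≡ just x
β₁-hop [] w₂<x ↑x∷R _ _ = β₁-leader w₂<x ↑x∷R
β₁-hop {x} {b} {w₂ = w₂} {R} (snoc u {l} x<l) w₂<x ↑x∷R β₁π≡b b≤x
  with barrier u l | dominates-around x<l w₂<x ↑x∷R
... | halts h l≤h β₁≡h | before , _ = contradiction (subst (l ≤_) h≡b l≤h) (<⇒≱ (≤-<-trans b≤x x<l))
  where
  h≡b : h ≡ b
  h≡b = just-injective (trans (sym (β₁≡h before))
          (trans (cong β₁ (sym (trans (++-assoc (u ∷ʳ l) w₂ (x ∷ R)) (∷ʳ-++ u l _)))) β₁π≡b))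
... | passes β≡ | _ , after = begin
  β₁ ((u ∷ʳ l) ++ x ∷ w₂ ++ R)  ≡⟨ cong β₁ (∷ʳ-++ u l _) ⟩
  β₁ (u ++ l ∷ x ∷ w₂ ++ R)     ≡⟨ cong head (β≡ after) ⟩
  β₁ (x ∷ w₂ ++ R)              ≡⟨ β₁-leader w₂<x ↑x∷R ⟩
  just x                        ∎
  where open ≡-Reasoning

lowRun-split : ∀ x L → x ∉ L → ∃₂ λ w₁ w₂ → L ≡ w₁ ++ w₂ × EndsAbove x w₁ × All (_< x) w₂
lowRun-split x []      _  = [] , [] , refl , [] , []
lowRun-split x (y ∷ L) x∉ with lowRun-split x L (λ x∈L → x∉ (there x∈L))
... | .(u ∷ʳ l) , w₂ , refl , snoc u {l} x<l , w₂<x = (y ∷ u) ∷ʳ l , w₂ , refl , snoc (y ∷ u) x<l , w₂<x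
... | [] , w₂ , refl , [] , w₂<x with y <? x
...   | yes y<x = [] , y ∷ w₂ , refl , [] , y<x ∷ w₂<x
...   | no  y≮x = [] ∷ʳ y , w₂ , refl , snoc [] (≤∧≢⇒< (≮⇒≥ y≮x) (λ x≡y → x∉ (here x≡y))) , w₂<x

EndsAbove-leftBelow : ∀ {x w} → EndsAbove x w → leftBelow (last w) x ≡ false
EndsAbove-leftBelow []               = refl
EndsAbove-leftBelow (snoc u {l} x<l) rewrite last-∷ʳ u l = ≥⇒<ᵇ≡false (<⇒≤ x<l)

EndsAbove-stops : ∀ {x w} → EndsAbove x w → MaybeAll (λ z → (z <ᵇ x) ≡ false) (head (reverse w))
EndsAbove-stops []               = nothing
EndsAbove-stops (snoc u {l} x<l) rewrite reverse-++ u (l ∷ []) = just (≥⇒<ᵇ≡false (<⇒≤ x<l))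

increasing-stops : ∀ {x R} → Linked _<_ (x ∷ R) → MaybeAll (λ r → (r <ᵇ x) ≡ false) (head R)
increasing-stops [-]       = nothing
increasing-stops (x<r ∷ _) = just (≥⇒<ᵇ≡false (<⇒≤ x<r))

increasing-belowRight : ∀ {x R} → Linked _<_ (x ∷ R) → belowRight x (head R) ≡ true
increasing-belowRight [-]       = refl
increasing-belowRight (x<r ∷ _) = <⇒<ᵇ≡true x<r

-- x is a valley when w₂ is empty and a double ascent otherwise.
hoppable-branch : ∀ {x} w₁ w₂ R → EndsAbove x w₁ → All (_< x) w₂ → belowRight x (head R) ≡ true →
                  (if hoppable (last (w₁ ++ w₂)) x (head R) then w₁ ++ x ∷ w₂ ++ R else (w₁ ++ w₂) ++ x ∷ R)
                  ≡ w₁ ++ x ∷ w₂ ++ R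
hoppable-branch w₁ w₂ R ↑w₁ w₂<x x<R with initLast w₂
hoppable-branch w₁ .[] R ↑w₁ w₂<x x<R | []
  rewrite ++-identityʳ w₁ | EndsAbove-leftBelow ↑w₁ | x<R = refl
hoppable-branch w₁ .(w₂ ∷ʳ t) R ↑w₁ w₂t<x x<R | w₂ ∷ʳ′ t
  rewrite sym (++-assoc w₁ w₂ (t ∷ [])) | last-∷ʳ (w₁ ++ w₂) t
        | <⇒<ᵇ≡true (proj₂ (All.∷ʳ⁻ w₂t<x)) | x<R = refl

φ-hop : ∀ {x} w₁ w₂ R → x ∉ w₁ ++ w₂ → EndsAbove x w₁ → All (_< x) w₂ → Linked _<_ (x ∷ R) →
        φ x ((w₁ ++ w₂) ++ x ∷ R) ≡ w₁ ++ x ∷ w₂ ++ R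
φ-hop w₁ w₂ R x∉ ↑w₁ w₂<x ↑x∷R
  rewrite splitOn-first (w₁ ++ w₂) R x∉
        | takeWhileB-++ [] [] (increasing-stops ↑x∷R) | dropWhileB-++ [] [] (increasing-stops ↑x∷R)
        | reverse-++ w₁ w₂
        | takeWhileB-++ (reverse w₂) (All-reverse⁺ (All.map <⇒<ᵇ≡true w₂<x)) (EndsAbove-stops ↑w₁)
        | dropWhileB-++ (reverse w₂) (All-reverse⁺ (All.map <⇒<ᵇ≡true w₂<x)) (EndsAbove-stops ↑w₁)
        | reverse-involutive w₁ | reverse-involutive w₂
  = hoppable-branch w₁ w₂ R ↑w₁ w₂<x (increasing-belowRight ↑x∷R)

decrPrefix-prefix : ∀ r → ∃ λ rest → r ≡ decrPrefix r ++ rest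
decrPrefix-prefix []          = [] , refl
decrPrefix-prefix (a ∷ [])    = [] , refl
decrPrefix-prefix (a ∷ b ∷ t) with b <ᵇ a | decrPrefix-prefix (b ∷ t)
... | true  | rest , eq = rest , cong (a ∷_) eq
... | false | _         = b ∷ t , refl

decrPrefix-below : ∀ {z} a t → a < z → Linked _>_ (z ∷ decrPrefix (a ∷ t))
decrPrefix-below a []      a<z = a<z ∷ [-]
decrPrefix-below a (b ∷ t) a<z with b <ᵇ a | <ᵇ-reflects-< b a
... | true  | ofʸ b<a = a<z ∷ decrPrefix-below b t b<a
... | false | _       = a<z ∷ [-]

decrPrefix-decreasing : ∀ r → Linked _>_ (decrPrefix r)
decrPrefix-decreasing []      = []
decrPrefix-decreasing (a ∷ t) = Linked.tail (decrPrefix-below a t (n<1+n a))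

maxIncSuffix-split : ∀ π {x} → x ∈ maxIncSuffix π → ∃₂ λ L R → π ≡ L ++ x ∷ R × Linked _<_ (x ∷ R)
maxIncSuffix-split π {x} x∈ with decrPrefix-prefix (reverse π) | ∈-∃++ x∈
... | rest , π̃≡ | ys , zs , suffix≡ =
  reverse rest ++ ys , zs , π≡ ,
  Linked-++⁻ʳ ys (subst (Linked _<_) suffix≡ (Linked-reverse⁺ (decrPrefix-decreasing (reverse π))))
  where
  open ≡-Reasoning
  D = decrPrefix (reverse π)
  π≡ : π ≡ (reverse rest ++ ys) ++ x ∷ zs
  π≡ = begin
    π                              ≡⟨ reverse-involutive π ⟨
    reverse (reverse π)            ≡⟨ cong reverse π̃≡ ⟩
    reverse (D ++ rest)            ≡⟨ reverse-++ D rest ⟩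
    reverse rest ++ reverse D      ≡⟨ cong (reverse rest ++_) suffix≡ ⟩
    reverse rest ++ ys ++ x ∷ zs   ≡⟨ ++-assoc (reverse rest) ys (x ∷ zs) ⟨
    (reverse rest ++ ys) ++ x ∷ zs ∎

Unique-permutation : ∀ {n π} → π ↭ map suc (upTo n) → Unique π
Unique-permutation {n} π↭ =
  ↭ₛ.Unique-resp-↭ (setoid ℕ) (↭⇒↭ₛ (↭-sym π↭)) (Unique.map⁺ suc-injective (Unique.upTo⁺ n))

lemma23 : (n : ℕ) (π : List ℕ) → π ↭ map suc (upTo n) →
          (x : ℕ) → x ∈Rix π → β₁ (φ x π) ≡ just x
lemma23 n π π↭ x (x∈suffix , b , β₁π≡b , b≤x)
  with L , R , refl , ↑x∷R ← maxIncSuffix-split π x∈suffix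
  with x∉L ← Unique-∉-prefix L (Unique-permutation π↭)
  with w₁ , w₂ , refl , ↑w₁ , w₂<x ← lowRun-split x L x∉L = begin
    β₁ (φ x ((w₁ ++ w₂) ++ x ∷ R)) ≡⟨ cong β₁ (φ-hop w₁ w₂ R x∉L ↑w₁ w₂<x ↑x∷R) ⟩
    β₁ (w₁ ++ x ∷ w₂ ++ R)         ≡⟨ β₁-hop ↑w₁ w₂<x ↑x∷R β₁π≡b b≤x ⟩
    just x                         ∎
  where open ≡-Reasoning
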